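{- For all $d\geq 2$, there exists a $d$-regular graph $G$ with $\chi_s(G)=\left\lceil\frac{d+4}{2}\right\rceil$.
   Context: A $k$-star colouring of a graph is a proper vertex colouring with $k$ colours in which no path on 4 vertices receives only two colours; $\chi_s(G)$ is the least $k$ for which $G$ admits a $k$-star colouring. -}

module Defs where

open import Data.Nat using (ℕ; _<_; _/_)
open import Data.Bool using (Bool; true; false)
open import Data.Fin using (Fin)
open import Data.List using (List; filter; length; allFin)
open import Data.Bool using (T)
open import Data.Product using (Σ; _×_)
open import Relation.Binary.PropositionalEquality using (_≡_; _≢_)
open import Relation.Nullary using (¬_)

record Graph : Set where
  field
    n     : ℕ
    adj   : Fin n → Fin n → Bool
    sym   : ∀ u v → adj u v ≡ adj v u
    irrefl : ∀ v → adj v v ≡ false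

open Graph public

Adj : (G : Graph) → Fin (n G) → Fin (n G) → Set
Adj G u v = adj G u v ≡ true

degree : (G : Graph) → Fin (n G) → ℕ
degree G v = length (filter (λ u → T? (adj G v u)) (allFin (n G)))
  where open import Data.Bool.Properties using (T?)

Regular : ℕ → Graph → Set
Regular d G = ∀ v → degree G v ≡ d

Proper : (G : Graph) (k : ℕ) → (Fin (n G) → Fin k) → Set
Proper G k c = ∀ u v → Adj G u v → c u ≢ c v

-- a path on 4 vertices v₁ v₂ v₃ v₄ (pairwise distinct, consecutive ones adjacent)
-- receives only two colours; in a proper colouring this means c v₁ = c v₃ and c v₂ = c v₄
Bicoloured4Path : (G : Graph) (k : ℕ) → (Fin (n G) → Fin k) → Set
Bicoloured4Path G k c =
  Σ (Fin (n G)) λ v₁ → Σ (Fin (n G)) λ v₂ → Σ (Fin (n G)) λ v₃ → Σ (Fin (n G)) λ v₄ →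
    (v₁ ≢ v₂ × v₁ ≢ v₃ × v₁ ≢ v₄ × v₂ ≢ v₃ × v₂ ≢ v₄ × v₃ ≢ v₄) ×
    (Adj G v₁ v₂ × Adj G v₂ v₃ × Adj G v₃ v₄) ×
    (c v₁ ≡ c v₃ × c v₂ ≡ c v₄)

IsStarColouring : (G : Graph) (k : ℕ) → (Fin (n G) → Fin k) → Set
IsStarColouring G k c = Proper G k c × ¬ Bicoloured4Path G k c

StarColourable : Graph → ℕ → Set
StarColourable G k = Σ (Fin (n G) → Fin k) λ c → IsStarColouring G k c

StarChromaticNumber : Graph → ℕ → Set
StarChromaticNumber G k = StarColourable G k × (∀ j → j < k → ¬ StarColourable G j)

-- ⌈(d+4)/2⌉ = ⌊(d+5)/2⌋
ceilHalf : ℕ → ℕ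
ceilHalf m = (m Data.Nat.+ 1) / 2
  where import Data.Nat

{-# OPTIONS --safe #-}
-- Lower bound: in a star colouring every edge uv has an end, say u, that is the only
-- neighbour of v in its colour, since otherwise a second neighbour on each side yields a
-- bicoloured path on four vertices. Double counting over the edges then gives
-- n d ≤ 2 Σ_u W(u), where W(u) counts the neighbours of u whose colour occurs exactly once
-- around u. With p ≤ d colours, the colour of u does not occur around u and some colour
-- occurs twice, so W(u) ≤ p − 2 and d + 4 ≤ 2p; for p > d this is immediate as d ≥ 2.
--
-- Upper bound: with K colours, take the ordered pairs (a, b) of distinct colours as
-- vertices, coloured by a, and join (a, b) to (b, e) for every e ≠ a. Then (a, b) is the
-- only neighbour of (b, e) of colour a, so every edge has such an end; the graph is
-- 2(K − 2)-regular. For odd degree, let σ_b be a cyclic permutation of the colours other than b,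
-- delete the edges (a, b)(b, σ_b a) and add the perfect matching (a, σ_a c)(c, σ_c a);
-- every edge keeps a sole end and the degree becomes 2(K − 3) + 1.
module Submission where

open import Defs hiding (sym)
open import Data.Bool using (Bool; true; false; T; if_then_else_)
open import Data.Bool.Properties using (T?) renaming (_≟_ to _≟ᵇ_)
open import Data.Empty using (⊥; ⊥-elim)
open import Data.Fin using (Fin; zero; suc; toℕ; fromℕ; inject₁; punchIn; punchOut; _≟_; _↑ˡ_; _↑ʳ_; combine; remQuot)
open import Data.Fin.Properties using (punchInᵢ≢i; punchIn-injective; combine-remQuot; remQuot-combine; punchIn-punchOut; punchOut-punchIn; punchOut-cong; toℕ-inject₁; any?)
open import Data.List using (filter; length; tabulate)
open import Data.Nat using (ℕ; zero; suc; _+_; _*_; _≤_; _<_; z≤n; s≤s; s≤s⁻¹; _≤?_; >-nonZero)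
open import Data.Nat.Properties hiding (_≟_)
open import Data.Nat.Tactic.RingSolver using (solve-∀)
open import Data.Nat.DivMod using (m/n≡1+[m∸n]/n; m/n*n≤m)
open import Data.Nat.Properties using () renaming (_≟_ to _≟ℕ_)
open import Data.Product using (Σ; ∃; _×_; _,_; proj₁; proj₂; uncurry)
open import Level using (Level)
open import Function using (_∘_; _$_; _⇔_; mk⇔)
open import Relation.Binary.PropositionalEquality using (_≡_; _≢_; refl; sym; trans; cong; cong₂; subst; module ≡-Reasoning)
open import Relation.Nullary using (Dec; yes; no; does; ¬_; contradiction)
open import Relation.Nullary.Decidable using (¬?; _×-dec_; _⊎-dec_; _→-dec_; dec-true; dec-false; does-⇔)
open import Relation.Unary using (Pred; Decidable)
open import Data.Sum using (_⊎_; inj₁; inj₂)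

open import Algebra.Properties.Semiring.Sum +-*-semiring
  using (sum; sum-syntax; sum-cong-≗; ∑-distrib-+; ∑-comm; sum-remove; sum-init-last; sum-replicate-zero; *-distribˡ-sum; *-distribʳ-sum)

private variable
  a : Level
  X Y : Set a
  k : ℕ

[_] : Dec X → ℕ
[ a? ] = if does a? then 1 else 0

[]-yes : (a? : Dec X) → X → [ a? ] ≡ 1
[]-yes a? x = cong (λ t → if t then 1 else 0) (dec-true a? x)

[]-no : (a? : Dec X) → ¬ X → [ a? ] ≡ 0
[]-no a? ¬x = cong (λ t → if t then 1 else 0) (dec-false a? ¬x)

does⇒ : (a? : Dec X) → does a? ≡ true → X
does⇒ (yes x) _ = x

[]≤1 : (a? : Dec X) → [ a? ] ≤ 1
[]≤1 (yes _) = s≤s z≤n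
[]≤1 (no _)  = z≤n

[]-⇔ : X ⇔ Y → (a? : Dec X) (b? : Dec Y) → [ a? ] ≡ [ b? ]
[]-⇔ X⇔Y a? b? = cong (λ t → if t then 1 else 0) (does-⇔ X⇔Y a? b?)

[]-× : (a? : Dec X) (b? : Dec Y) → [ a? ×-dec b? ] ≡ [ a? ] * [ b? ]
[]-× (yes _) (yes _) = refl
[]-× (yes _) (no _)  = refl
[]-× (no _)  _       = refl

[]-⊎ : (a? : Dec X) (b? : Dec Y) → (X → Y → ⊥) → [ a? ⊎-dec b? ] ≡ [ a? ] + [ b? ]
[]-⊎ (yes x) (yes y) disj = ⊥-elim (disj x y)
[]-⊎ (yes _) (no _)  _    = refl
[]-⊎ (no _)  (yes _) _    = refl
[]-⊎ (no _)  (no _)  _    = refl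

[¬]+[] : (a? : Dec X) → [ ¬? a? ] + [ a? ] ≡ 1
[¬]+[] (yes _) = refl
[¬]+[] (no _)  = refl

sum-mono-≤ : {f g : Fin k → ℕ} → (∀ i → f i ≤ g i) → sum f ≤ sum g
sum-mono-≤ {zero}  f≤g = z≤n
sum-mono-≤ {suc k} f≤g = +-mono-≤ (f≤g zero) (sum-mono-≤ (f≤g ∘ suc))

sum-distrib-+₃ : ∀ (f g h : Fin k → ℕ) → ∑[ i < k ] (f i + (g i + h i)) ≡ sum f + (sum g + sum h)
sum-distrib-+₃ f g h = trans (∑-distrib-+ f (λ i → g i + h i)) (cong (sum f +_) (∑-distrib-+ g h))

sum-const : ∀ k c → ∑[ i < k ] c ≡ k * c
sum-const zero    c = refl
sum-const (suc k) c = cong (c +_) (sum-const k c)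

sum-zero : {f : Fin k → ℕ} → (∀ i → f i ≡ 0) → sum f ≡ 0
sum-zero {k} f≡0 = trans (sum-cong-≗ f≡0) (sum-replicate-zero k)

sum-onePoint : ∀ {f : Fin k → ℕ} i → (∀ j → j ≢ i → f j ≡ 0) → sum f ≡ f i
sum-onePoint {suc k} {f} i others≡0 = begin
  sum f                                ≡⟨ sum-remove {i = i} f ⟩
  f i + ∑[ j < k ] f (punchIn i j)      ≡⟨ cong (f i +_) (sum-zero (λ j → others≡0 _ (punchInᵢ≢i i j))) ⟩
  f i + 0                              ≡⟨ +-identityʳ (f i) ⟩
  f i                                  ∎
  where open ≡-Reasoning

sum-pick : ∀ (i : Fin k) (g : Fin k → ℕ) → ∑[ j < k ] ([ j ≟ i ] * g j) ≡ g i
sum-pick i g = trans (sum-onePoint i (λ j j≢i → cong (_* g j) ([]-no (j ≟ i) j≢i)))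
                     (trans (cong (_* g i) ([]-yes (i ≟ i) refl)) (+-identityʳ (g i)))

sum-[≟i] : ∀ (i : Fin k) → ∑[ j < k ] [ j ≟ i ] ≡ 1
sum-[≟i] i = trans (sum-cong-≗ (λ j → sym (*-identityʳ [ j ≟ i ]))) (sum-pick i (λ _ → 1))

sum-[i≟] : ∀ (i : Fin k) → ∑[ j < k ] [ i ≟ j ] ≡ 1
sum-[i≟] i = trans (sum-cong-≗ (λ j → []-⇔ (mk⇔ sym sym) (i ≟ j) (j ≟ i))) (sum-[≟i] i)

sum-[¬]+sum-[] : {P : Pred (Fin k) a} (P? : Decidable P) → ∑[ i < k ] [ ¬? (P? i) ] + ∑[ i < k ] [ P? i ] ≡ k
sum-[¬]+sum-[] {k} P? = begin
  ∑[ i < k ] [ ¬? (P? i) ] + ∑[ i < k ] [ P? i ]  ≡⟨ ∑-distrib-+ (λ i → [ ¬? (P? i) ]) (λ i → [ P? i ]) ⟨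
  ∑[ i < k ] ([ ¬? (P? i) ] + [ P? i ])          ≡⟨ sum-cong-≗ (λ i → [¬]+[] (P? i)) ⟩
  ∑[ i < k ] 1                                   ≡⟨ trans (sum-const k 1) (*-identityʳ k) ⟩
  k                                              ∎
  where open ≡-Reasoning

sum≤size : {f : Fin k → ℕ} → (∀ i → f i ≤ 1) → sum f ≤ k
sum≤size {k} f≤1 = ≤-trans (sum-mono-≤ f≤1) (≤-reflexive (trans (sum-const k 1) (*-identityʳ k)))

sum<size : {f : Fin k → ℕ} (i : Fin k) → (∀ j → f j ≤ 1) → f i ≡ 0 → sum f < k
sum<size {suc k} {f} i f≤1 fi≡0 = begin-strict
  sum f                           ≡⟨ sum-remove {i = i} f ⟩
  f i + ∑[ j < k ] f (punchIn i j) ≡⟨ cong (_+ ∑[ j < k ] f (punchIn i j)) fi≡0 ⟩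
  ∑[ j < k ] f (punchIn i j)       ≤⟨ sum≤size (f≤1 ∘ punchIn i) ⟩
  k                               <⟨ n<1+n k ⟩
  suc k                           ∎
  where open ≤-Reasoning

2+sum≤size : {f : Fin k → ℕ} (i j : Fin k) → i ≢ j → (∀ l → f l ≤ 1) → f i ≡ 0 → f j ≡ 0 → 2 + sum f ≤ k
2+sum≤size {suc k} {f} i j i≢j f≤1 fi≡0 fj≡0 = begin
  2 + sum f                            ≡⟨ cong (2 +_) (sum-remove {i = i} f) ⟩
  2 + (f i + ∑[ l < k ] f (punchIn i l)) ≡⟨ cong (λ t → 2 + (t + ∑[ l < k ] f (punchIn i l))) fi≡0 ⟩
  2 + ∑[ l < k ] f (punchIn i l)         ≤⟨ s≤s (sum<size (punchOut i≢j) (f≤1 ∘ punchIn i) (trans (cong f (punchIn-punchOut i≢j)) fj≡0)) ⟩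
  suc k                                ∎
  where open ≤-Reasoning

pigeonhole : {f : Fin k → ℕ} (i : Fin k) → f i ≡ 0 → k ≤ sum f → ∃ λ j → 2 ≤ f j
pigeonhole {k} {f} i fi≡0 k≤sum with any? (λ j → 2 ≤? f j)
... | yes found = found
... | no none = contradiction k≤sum (<⇒≱ (sum<size i f≤1 fi≡0))
  where
  f≤1 : ∀ j → f j ≤ 1
  f≤1 j = ≮⇒≥ λ 1<fj → none (j , 1<fj)

length-filter-tabulate : {P : Pred X a} (P? : Decidable P) (f : Fin k → X) →
                         length (filter P? (tabulate f)) ≡ ∑[ i < k ] [ P? (f i) ]
length-filter-tabulate {k = zero}  P? f = refl
length-filter-tabulate {k = suc k} P? f with does (P? (f zero))
... | true  = cong suc (length-filter-tabulate P? (f ∘ suc))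
... | false = length-filter-tabulate P? (f ∘ suc)

sum-↑ : ∀ {l} (f : Fin (k + l) → ℕ) → sum f ≡ ∑[ i < k ] f (i ↑ˡ l) + ∑[ j < l ] f (k ↑ʳ j)
sum-↑ {zero}  f = refl
sum-↑ {suc k} {l} f = trans (cong (f zero +_) (sum-↑ {k} {l} (f ∘ suc))) (sym (+-assoc (f zero) _ _))

sum-combine : ∀ {l} (f : Fin (k * l) → ℕ) → sum f ≡ ∑[ i < k ] ∑[ j < l ] f (combine i j)
sum-combine {zero}      f = refl
sum-combine {suc k} {l} f = trans (sum-↑ {l} {k * l} f) (cong (∑[ j < l ] f (j ↑ˡ k * l) +_) (sum-combine {k} {l} (λ j → f (l ↑ʳ j))))

sum-[¬]+1≡size : {P : Pred (Fin k) a} (P? : Decidable P) →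
                 ∑[ i < k ] [ P? i ] ≡ 1 → ∑[ i < k ] [ ¬? (P? i) ] + 1 ≡ k
sum-[¬]+1≡size {k} P? one = trans (cong (∑[ i < k ] [ ¬? (P? i) ] +_) (sym one)) (sum-[¬]+sum-[] P?)

sum-[¬×¬]+2≡size : {P Q : Pred (Fin k) a} (P? : Decidable P) (Q? : Decidable Q) → (∀ i → P i → Q i → ⊥) →
                   ∑[ i < k ] [ P? i ] ≡ 1 → ∑[ i < k ] [ Q? i ] ≡ 1 →
                   ∑[ i < k ] [ ¬? (P? i) ×-dec ¬? (Q? i) ] + 2 ≡ k
sum-[¬×¬]+2≡size {k} P? Q? disjoint oneP oneQ = begin
  neither + 2                                               ≡⟨ cong₂ (λ s t → neither + (s + t)) oneP oneQ ⟨
  neither + (∑[ i < k ] [ P? i ] + ∑[ i < k ] [ Q? i ])      ≡⟨ cong (neither +_) (∑-distrib-+ (λ i → [ P? i ]) (λ i → [ Q? i ])) ⟨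
  neither + ∑[ i < k ] ([ P? i ] + [ Q? i ])                ≡⟨ ∑-distrib-+ (λ i → [ ¬? (P? i) ×-dec ¬? (Q? i) ]) (λ i → [ P? i ] + [ Q? i ]) ⟨
  ∑[ i < k ] ([ ¬? (P? i) ×-dec ¬? (Q? i) ] + ([ P? i ] + [ Q? i ])) ≡⟨ sum-cong-≗ (λ i → partition (P? i) (Q? i) (disjoint i)) ⟩
  ∑[ i < k ] 1                                              ≡⟨ trans (sum-const k 1) (*-identityʳ k) ⟩
  k                                                         ∎
  where
  open ≡-Reasoning
  neither = ∑[ i < k ] [ ¬? (P? i) ×-dec ¬? (Q? i) ]
  partition : (x? : Dec X) (y? : Dec Y) → (X → Y → ⊥) → [ ¬? x? ×-dec ¬? y? ] + ([ x? ] + [ y? ]) ≡ 1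
  partition (yes x) (yes y) disj = ⊥-elim (disj x y)
  partition (yes _) (no _)  _    = refl
  partition (no _)  (yes _) _    = refl
  partition (no _)  (no _)  _    = refl

sum-[¬×⇒¬]+1+b≡size : ∀ (b : Bool) {P Q : Pred (Fin k) a} (P? : Decidable P) (Q? : Decidable Q) →
                      (∀ i → P i → Q i → ⊥) → ∑[ i < k ] [ P? i ] ≡ 1 → ∑[ i < k ] [ Q? i ] ≡ 1 →
                      ∑[ i < k ] [ ¬? (P? i) ×-dec (T? b →-dec ¬? (Q? i)) ] + (1 + [ T? b ]) ≡ k
sum-[¬×⇒¬]+1+b≡size false P? Q? _ oneP _ =
  trans (cong (_+ 1) (sum-cong-≗ (λ i → trans ([]-× (¬? (P? i)) (T? false →-dec ¬? (Q? i))) (*-identityʳ [ ¬? (P? i) ])))) (sum-[¬]+1≡size P? oneP)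
sum-[¬×⇒¬]+1+b≡size true P? Q? disjoint oneP oneQ =
  trans (cong (_+ 2) (sum-cong-≗ (λ i → trans ([]-× (¬? (P? i)) (T? true →-dec ¬? (Q? i))) (sym ([]-× (¬? (P? i)) (¬? (Q? i)))))))
        (sum-[¬×¬]+2≡size P? Q? disjoint oneP oneQ)

degree≡sum : (G : Graph) (u : Fin (n G)) → degree G u ≡ ∑[ v < n G ] [ T? (adj G u v) ]
degree≡sum G u = length-filter-tabulate (T? ∘ adj G u) (λ v → v)

SoleOfColour : (G : Graph) {k : ℕ} → (Fin (n G) → Fin k) → Fin (n G) → Fin (n G) → Set
SoleOfColour G κ u v = ∀ w → Adj G v w → κ w ≡ κ u → w ≡ u

sole-ends⇒star : (G : Graph) {k : ℕ} (κ : Fin (n G) → Fin k) → Proper G k κ →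
                 (∀ u v → Adj G u v → SoleOfColour G κ u v ⊎ SoleOfColour G κ v u) →
                 IsStarColouring G k κ
sole-ends⇒star G κ proper sole = proper , no-bicoloured-path
  where
  no-bicoloured-path : ¬ Bicoloured4Path G _ κ
  no-bicoloured-path (x , u , v , y , (_ , x≢v , _ , _ , u≢y , _) , (xu , uv , vy) , (κx≡κv , κu≡κy))
    with sole u v uv
  ... | inj₁ u-sole = u≢y (sym (u-sole y vy (sym κu≡κy)))
  ... | inj₂ v-sole = x≢v (v-sole x (trans (Graph.sym G u x) xu) κx≡κv)

module StarColouringBound (G : Graph) {p : ℕ} (κ : Fin (n G) → Fin p)
                          (star : IsStarColouring G p κ) where

  private
    V = Fin (n G)

    proper = proj₁ star
    noBicoloured = proj₂ star

    A : V → V → ℕ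
    A u v = [ T? (adj G u v) ]

  colourDegree : V → Fin p → ℕ
  colourDegree u c = ∑[ v < n G ] (A u v * [ κ v ≟ c ])

  once : V → Fin p → ℕ
  once u c = [ colourDegree u c ≟ℕ 1 ]

  sum-by-colour : ∀ u (h : Fin p → ℕ) → ∑[ v < n G ] (A u v * h (κ v)) ≡ ∑[ c < p ] (colourDegree u c * h c)
  sum-by-colour u h = begin
    ∑[ v < n G ] (A u v * h (κ v))                            ≡⟨ sum-cong-≗ (λ v → cong (A u v *_) (sum-pick' (κ v))) ⟨
    ∑[ v < n G ] (A u v * ∑[ c < p ] ([ κ v ≟ c ] * h c))     ≡⟨ sum-cong-≗ (λ v → *-distribˡ-sum (A u v) (λ c → [ κ v ≟ c ] * h c)) ⟩
    ∑[ v < n G ] ∑[ c < p ] (A u v * ([ κ v ≟ c ] * h c))     ≡⟨ ∑-comm (λ v c → A u v * ([ κ v ≟ c ] * h c)) ⟩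
    ∑[ c < p ] ∑[ v < n G ] (A u v * ([ κ v ≟ c ] * h c))     ≡⟨ sum-cong-≗ (λ c → sum-cong-≗ (λ v → sym (*-assoc (A u v) _ (h c)))) ⟩
    ∑[ c < p ] ∑[ v < n G ] (A u v * [ κ v ≟ c ] * h c)       ≡⟨ sum-cong-≗ (λ c → *-distribʳ-sum (h c) (λ v → A u v * [ κ v ≟ c ])) ⟨
    ∑[ c < p ] (colourDegree u c * h c)                       ∎
    where
    open ≡-Reasoning
    sum-pick' : ∀ c → ∑[ c′ < p ] ([ c ≟ c′ ] * h c′) ≡ h c
    sum-pick' c = trans (sum-cong-≗ (λ c′ → cong (_* h c′) ([]-⇔ (mk⇔ sym sym) (c ≟ c′) (c′ ≟ c)))) (sum-pick c h)

  colourDegree-own : ∀ u → colourDegree u (κ u) ≡ 0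
  colourDegree-own u = sum-zero term
    where
    term : ∀ v → A u v * [ κ v ≟ κ u ] ≡ 0
    term v with adj G u v in uv
    ... | false = refl
    ... | true  = cong (1 *_) ([]-no (κ v ≟ κ u) (λ κv≡κu → proper u v uv (sym κv≡κu)))

  degree≡sum-colourDegree : ∀ u → degree G u ≡ ∑[ c < p ] colourDegree u c
  degree≡sum-colourDegree u = begin
    degree G u                           ≡⟨ degree≡sum G u ⟩
    ∑[ v < n G ] A u v                   ≡⟨ sum-cong-≗ (λ v → *-identityʳ (A u v)) ⟨
    ∑[ v < n G ] (A u v * 1)             ≡⟨ sum-by-colour u (λ _ → 1) ⟩
    ∑[ c < p ] (colourDegree u c * 1)    ≡⟨ sum-cong-≗ (λ c → *-identityʳ (colourDegree u c)) ⟩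
    ∑[ c < p ] colourDegree u c          ∎
    where open ≡-Reasoning

  another-neighbour : ∀ {u v} → Adj G u v → colourDegree u (κ v) ≢ 1 →
                      ∃ λ x → x ≢ v × Adj G u x × κ x ≡ κ v
  another-neighbour {u} {v} uv ≢1 with any? (λ x → ¬? (x ≟ v) ×-dec (adj G u x ≟ᵇ true) ×-dec (κ x ≟ κ v))
  ... | yes found = found
  ... | no none = contradiction (trans (sum-onePoint v only-v) at-v) ≢1
    where
    only-v : ∀ x → x ≢ v → A u x * [ κ x ≟ κ v ] ≡ 0
    only-v x x≢v with adj G u x in ux | κ x ≟ κ v
    ... | false | _          = refl
    ... | true  | no _       = refl
    ... | true  | yes κx≡κv = ⊥-elim (none (x , x≢v , ux , κx≡κv))
    at-v : A u v * [ κ v ≟ κ v ] ≡ 1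
    at-v rewrite uv | []-yes (κ v ≟ κ v) refl = refl

  once-at-an-end : ∀ {u v} → Adj G u v → colourDegree u (κ v) ≡ 1 ⊎ colourDegree v (κ u) ≡ 1
  once-at-an-end {u} {v} uv with colourDegree u (κ v) ≟ℕ 1 | colourDegree v (κ u) ≟ℕ 1
  ... | yes once₁ | _        = inj₁ once₁
  ... | no _      | yes once₂ = inj₂ once₂
  ... | no ≢1     | no ≢1′   = ⊥-elim $
    noBicoloured (x , u , v , y , (x≢u , x≢v , x≢y , u≢v , u≢y , v≢y) , (xu , uv , vy) , (κx≡κv , sym κy≡κu))
    where
    vu : Adj G v u
    vu = trans (Graph.sym G v u) uv
    κu≢κv : κ u ≢ κ v
    κu≢κv = proper u v uv
    x-neighbour = another-neighbour uv ≢1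
    y-neighbour = another-neighbour vu ≢1′
    x = proj₁ x-neighbour
    y = proj₁ y-neighbour
    x≢v = proj₁ (proj₂ x-neighbour)
    y≢u = proj₁ (proj₂ y-neighbour)
    xu : Adj G x u
    xu = trans (Graph.sym G x u) (proj₁ (proj₂ (proj₂ x-neighbour)))
    vy = proj₁ (proj₂ (proj₂ y-neighbour))
    κx≡κv = proj₂ (proj₂ (proj₂ x-neighbour))
    κy≡κu = proj₂ (proj₂ (proj₂ y-neighbour))
    x≢u : x ≢ u
    x≢u x≡u = κu≢κv (trans (cong κ (sym x≡u)) κx≡κv)
    x≢y : x ≢ y
    x≢y x≡y = κu≢κv (trans (sym κy≡κu) (trans (cong κ (sym x≡y)) κx≡κv))
    u≢v : u ≢ v
    u≢v u≡v = κu≢κv (cong κ u≡v)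
    u≢y : u ≢ y
    u≢y u≡y = y≢u (sym u≡y)
    v≢y : v ≢ y
    v≢y v≡y = κu≢κv (trans (sym κy≡κu) (cong κ (sym v≡y)))

  edge≤once+once : ∀ u v → A u v ≤ A u v * once u (κ v) + A v u * once v (κ u)
  edge≤once+once u v with adj G u v in uv
  ... | false = z≤n
  ... | true rewrite trans (Graph.sym G v u) uv with once-at-an-end uv
  ...   | inj₁ once₁ rewrite []-yes (colourDegree u (κ v) ≟ℕ 1) once₁ = s≤s z≤n
  ...   | inj₂ once₂ rewrite []-yes (colourDegree v (κ u) ≟ℕ 1) once₂ = m≤n+m 1 _

  onceNeighbours : V → ℕ
  onceNeighbours u = ∑[ v < n G ] (A u v * once u (κ v))

  handshake : ∀ {d} → Regular d G →
              n G * d ≤ ∑[ u < n G ] onceNeighbours u + ∑[ u < n G ] onceNeighbours u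
  handshake {d} regular = begin
    n G * d                                                               ≡⟨ sum-const (n G) d ⟨
    ∑[ u < n G ] d                                                        ≡⟨ sum-cong-≗ (λ u → trans (sym (regular u)) (degree≡sum G u)) ⟩
    ∑[ u < n G ] ∑[ v < n G ] A u v                                       ≤⟨ sum-mono-≤ (λ u → sum-mono-≤ (edge≤once+once u)) ⟩
    ∑[ u < n G ] ∑[ v < n G ] (A u v * once u (κ v) + A v u * once v (κ u)) ≡⟨ sum-cong-≗ (λ u → ∑-distrib-+ (λ v → A u v * once u (κ v)) (λ v → A v u * once v (κ u))) ⟩
    ∑[ u < n G ] (onceNeighbours u + ∑[ v < n G ] (A v u * once v (κ u)))   ≡⟨ ∑-distrib-+ onceNeighbours (λ u → ∑[ v < n G ] (A v u * once v (κ u))) ⟩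
    ∑[ u < n G ] onceNeighbours u + ∑[ u < n G ] ∑[ v < n G ] (A v u * once v (κ u)) ≡⟨ cong (∑[ u < n G ] onceNeighbours u +_) (∑-comm (λ u v → A v u * once v (κ u))) ⟩
    ∑[ u < n G ] onceNeighbours u + ∑[ u < n G ] onceNeighbours u          ∎
    where open ≤-Reasoning

  2+onceNeighbours≤colours : ∀ {d} → Regular d G → p ≤ d → ∀ u → 2 + onceNeighbours u ≤ p
  2+onceNeighbours≤colours {d} regular p≤d u = begin
    2 + onceNeighbours u                 ≡⟨ cong (2 +_) (sum-by-colour u (once u)) ⟩
    2 + ∑[ c < p ] (colourDegree u c * once u c) ≤⟨ +-monoʳ-≤ 2 (sum-mono-≤ (λ c → x*[x≟1]≤[x≟1] (colourDegree u c))) ⟩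
    2 + ∑[ c < p ] once u c              ≤⟨ 2+sum≤size (κ u) c₀ κu≢c₀ (λ c → []≤1 (colourDegree u c ≟ℕ 1)) once-own once-c₀ ⟩
    p                                    ∎
    where
    open ≤-Reasoning
    x*[x≟1]≤[x≟1] : ∀ x → x * [ x ≟ℕ 1 ] ≤ [ x ≟ℕ 1 ]
    x*[x≟1]≤[x≟1] 0               = z≤n
    x*[x≟1]≤[x≟1] 1               = ≤-refl
    x*[x≟1]≤[x≟1] (suc (suc x)) = ≤-reflexive (*-zeroʳ (suc (suc x)))
    p≤sum : p ≤ ∑[ c < p ] colourDegree u c
    p≤sum = ≤-trans p≤d (≤-reflexive (trans (sym (regular u)) (degree≡sum-colourDegree u)))
    crowded = pigeonhole (κ u) (colourDegree-own u) p≤sum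
    c₀ = proj₁ crowded
    2≤colourDegree : 2 ≤ colourDegree u c₀
    2≤colourDegree = proj₂ crowded
    κu≢c₀ : κ u ≢ c₀
    κu≢c₀ κu≡c₀ = contradiction (subst (λ c → 2 ≤ colourDegree u c) (sym κu≡c₀) 2≤colourDegree)
                                (subst (λ k → ¬ 2 ≤ k) (sym (colourDegree-own u)) λ ())
    once-own : once u (κ u) ≡ 0
    once-own = []-no (colourDegree u (κ u) ≟ℕ 1) (λ ≡1 → 0≢1+n (trans (sym (colourDegree-own u)) ≡1))
    once-c₀ : once u c₀ ≡ 0
    once-c₀ = []-no (colourDegree u c₀ ≟ℕ 1) (λ ≡1 → <⇒≱ 2≤colourDegree (≤-reflexive ≡1))

  sum-2+onceNeighbours : ∑[ u < n G ] (2 + onceNeighbours u) ≡ n G * 2 + ∑[ u < n G ] onceNeighbours u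
  sum-2+onceNeighbours = trans (∑-distrib-+ (λ _ → 2) onceNeighbours) (cong (_+ ∑[ u < n G ] onceNeighbours u) (sum-const (n G) 2))

  colours-bound : ∀ {d} → Regular d G → p ≤ d → 0 < n G → d + 4 ≤ p + p
  colours-bound {d} regular p≤d n>0 = *-cancelˡ-≤ (n G) {{>-nonZero n>0}} $ begin
    n G * (d + 4)                ≡⟨ distribute (n G) d ⟩
    n G * d + (n G * 2 + n G * 2) ≤⟨ +-monoˡ-≤ _ (handshake regular) ⟩
    (S + S) + (n G * 2 + n G * 2) ≡⟨ regroup S (n G * 2) ⟩
    (n G * 2 + S) + (n G * 2 + S) ≡⟨ cong₂ _+_ sum-2+onceNeighbours sum-2+onceNeighbours ⟨
    S₂ + S₂                       ≤⟨ +-mono-≤ S₂≤ S₂≤ ⟩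
    n G * p + n G * p            ≡⟨ *-distribˡ-+ (n G) p p ⟨
    n G * (p + p)                ∎
    where
    open ≤-Reasoning
    S = ∑[ u < n G ] onceNeighbours u
    S₂ = ∑[ u < n G ] (2 + onceNeighbours u)
    S₂≤ : S₂ ≤ n G * p
    S₂≤ = ≤-trans (sum-mono-≤ (2+onceNeighbours≤colours regular p≤d)) (≤-reflexive (sum-const (n G) p))
    distribute : ∀ k d → k * (d + 4) ≡ k * d + (k * 2 + k * 2)
    distribute = solve-∀
    regroup : ∀ s t → (s + s) + (t + t) ≡ (t + s) + (t + s)
    regroup = solve-∀

star-colouring-bound : ∀ {d p} (G : Graph) → 2 ≤ d → Regular d G → 0 < n G → StarColourable G p → d + 4 ≤ p + p
star-colouring-bound {d} {p} G 2≤d regular n>0 (κ , star) with p ≤? d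
... | yes p≤d = StarColouringBound.colours-bound G κ star regular p≤d n>0
... | no p≰d = begin
  d + 4               ≡⟨ +-comm d 4 ⟩
  suc (suc (2 + d))   ≤⟨ s≤s (s≤s (+-monoˡ-≤ d 2≤d)) ⟩
  suc (suc (d + d))   ≡⟨ cong suc (+-suc d d) ⟨
  suc d + suc d       ≤⟨ +-mono-≤ d<p d<p ⟩
  p + p               ∎
  where
  open ≤-Reasoning
  d<p = ≰⇒> p≰d

rotate : Fin (suc k) → Fin (suc k)
rotate zero    = fromℕ _
rotate (suc i) = inject₁ i

rotate-≢ : ∀ (i : Fin (2 + k)) → rotate i ≢ i
rotate-≢ zero    ()
rotate-≢ (suc i) eq = 1+n≢n (trans (sym (cong toℕ eq)) (toℕ-inject₁ i))

sum-rotate : ∀ (f : Fin (suc k) → ℕ) → ∑[ i < suc k ] f (rotate i) ≡ sum f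
sum-rotate f = trans (+-comm (f (rotate zero)) _) (sym (sum-init-last f))

-- Total punchOut: the position of a among the elements other than c, junk when c ≡ a.
punchOut′ : Fin (suc (suc k)) → Fin (suc (suc k)) → Fin (suc k)
punchOut′ c a with c ≟ a
... | yes _   = zero
... | no c≢a = punchOut c≢a

punchOut′-punchIn : ∀ (c : Fin (suc (suc k))) j → punchOut′ c (punchIn c j) ≡ j
punchOut′-punchIn c j with c ≟ punchIn c j
... | yes c≡c[j] = ⊥-elim (punchInᵢ≢i c j (sym c≡c[j]))
... | no _       = trans (punchOut-cong c refl) (punchOut-punchIn c)

punchIn-punchOut′ : ∀ {c a : Fin (suc (suc k))} → c ≢ a → punchIn c (punchOut′ c a) ≡ a
punchIn-punchOut′ {c = c} {a} c≢a with c ≟ a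
... | yes c≡a = ⊥-elim (c≢a c≡a)
... | no c≢a′ = punchIn-punchOut c≢a′

punchOut′-≡ : ∀ {c a : Fin (suc (suc k))} {j} → a ≡ punchIn c j → punchOut′ c a ≡ j
punchOut′-≡ {c = c} {j = j} refl = punchOut′-punchIn c j

sum-fibres-punchIn : ∀ (a : Fin (suc (suc k))) (h : Fin (suc (suc k)) → ℕ) →
                     ∑[ c < suc (suc k) ] (∑[ l < suc k ] [ a ≟ punchIn c l ] * h c) ≡ ∑[ i < suc k ] h (punchIn a i)
sum-fibres-punchIn {k} a h = begin
  ∑[ c < suc (suc k) ] (fibre c * h c)                      ≡⟨ sum-remove {i = a} (λ c → fibre c * h c) ⟩
  fibre a * h a + ∑[ i < suc k ] (fibre (punchIn a i) * h (punchIn a i))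
    ≡⟨ cong₂ _+_ (cong (_* h a) fibre-a) (sum-cong-≗ (λ i → cong (_* h (punchIn a i)) (fibre-other (punchInᵢ≢i a i)))) ⟩
  ∑[ i < suc k ] (1 * h (punchIn a i))                      ≡⟨ sum-cong-≗ (λ i → *-identityˡ (h (punchIn a i))) ⟩
  ∑[ i < suc k ] h (punchIn a i)                            ∎
  where
  open ≡-Reasoning
  fibre : Fin (suc (suc k)) → ℕ
  fibre c = ∑[ l < suc k ] [ a ≟ punchIn c l ]
  fibre-a : fibre a ≡ 0
  fibre-a = sum-zero (λ l → []-no (a ≟ punchIn a l) (λ a≡a[l] → punchInᵢ≢i a l (sym a≡a[l])))
  fibre-other : ∀ {c} → c ≢ a → fibre c ≡ 1
  fibre-other {c} c≢a = trans (sum-cong-≗ (λ l → []-⇔ (mk⇔ punchOut′-≡ λ { refl → sym (punchIn-punchOut′ c≢a) }) (a ≟ punchIn c l) (punchOut′ c a ≟ l)))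
                              (sum-[i≟] (punchOut′ c a))

-- The pair (a , j) encodes the ordered pair of colours (a, punchIn a j), and
-- σ_b a = punchIn b (rotate (punchOut′ b a)).
module PairGraph (r : ℕ) (odd : Bool) where

  m K : ℕ
  m = 2 + r
  K = suc m

  Pair : Set
  Pair = Fin K × Fin m

  Allowed : Fin m → Fin m → Set
  Allowed i l = l ≢ i × (T odd → l ≢ rotate i)

  Out : Pair → Pair → Set
  Out (a , j) (c , l) = c ≡ punchIn a j × Allowed (punchOut′ c a) l

  Match : Pair → Pair → Set
  Match (a , j) (c , l) = T odd × c ≢ a × j ≡ rotate (punchOut′ a c) × l ≡ rotate (punchOut′ c a)

  Edge : Pair → Pair → Set
  Edge p q = Out p q ⊎ Out q p ⊎ Match p q

  Allowed? : ∀ i l → Dec (Allowed i l)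
  Allowed? i l = ¬? (l ≟ i) ×-dec (T? odd →-dec ¬? (l ≟ rotate i))

  Out? : ∀ p q → Dec (Out p q)
  Out? (a , j) (c , l) = c ≟ punchIn a j ×-dec Allowed? (punchOut′ c a) l

  Match? : ∀ p q → Dec (Match p q)
  Match? (a , j) (c , l) =
    T? odd ×-dec ¬? (c ≟ a) ×-dec j ≟ rotate (punchOut′ a c) ×-dec l ≟ rotate (punchOut′ c a)

  Edge? : ∀ p q → Dec (Edge p q)
  Edge? p q = Out? p q ⊎-dec Out? q p ⊎-dec Match? p q

  Edge-sym : ∀ p q → Edge p q → Edge q p
  Edge-sym p q (inj₁ out)                      = inj₂ (inj₁ out)
  Edge-sym p q (inj₂ (inj₁ out))               = inj₁ out
  Edge-sym p q (inj₂ (inj₂ (o , c≢a , j≡ , l≡))) = inj₂ (inj₂ (o , (λ a≡c → c≢a (sym a≡c)) , l≡ , j≡))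

  Edge-colours : ∀ p q → Edge p q → proj₁ p ≢ proj₁ q
  Edge-colours (a , j) (c , l) (inj₁ (c≡a[j] , _))        a≡c = punchInᵢ≢i a j (sym (trans a≡c c≡a[j]))
  Edge-colours (a , j) (c , l) (inj₂ (inj₁ (a≡c[l] , _))) a≡c = punchInᵢ≢i c l (sym (trans (sym a≡c) a≡c[l]))
  Edge-colours (a , j) (c , l) (inj₂ (inj₂ (_ , c≢a , _)))  a≡c = c≢a (sym a≡c)

  Sole : Pair → Pair → Set
  Sole p q = ∀ s → Edge q s → proj₁ s ≡ proj₁ p → s ≡ p

  Out⇒Sole : ∀ p q → Out p q → Sole p q
  Out⇒Sole (a , j) (c , l) (_ , l≢ , _) (.a , l′) (inj₁ (a≡c[l′] , _)) refl =
    ⊥-elim (l≢ (sym (punchOut′-≡ a≡c[l′])))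
  Out⇒Sole (a , j) (c , l) (c≡a[j] , _) (.a , l′) (inj₂ (inj₁ (c≡a[l′] , _))) refl =
    cong (a ,_) (punchIn-injective a l′ j (trans (sym c≡a[l′]) c≡a[j]))
  Out⇒Sole (a , j) (c , l) (_ , _ , l≢rot) (.a , l′) (inj₂ (inj₂ (o , _ , l≡rot , _))) refl =
    ⊥-elim (l≢rot o l≡rot)

  Match⇒Sole : ∀ p q → Match p q → Sole p q
  Match⇒Sole (a , j) (c , l) (_ , _ , _ , l≡rot) (.a , l′) (inj₁ (a≡c[l′] , _)) refl =
    ⊥-elim (rotate-≢ l (sym (trans l≡rot (cong rotate (punchOut′-≡ a≡c[l′])))))
  Match⇒Sole (a , j) (c , l) (o , _ , _ , l≡rot) (.a , l′) (inj₂ (inj₁ (_ , _ , l≢rot))) refl =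
    ⊥-elim (l≢rot o l≡rot)
  Match⇒Sole (a , j) (c , l) (_ , _ , j≡rot , _) (.a , l′) (inj₂ (inj₂ (_ , _ , _ , l′≡rot))) refl =
    cong (a ,_) (trans l′≡rot (sym j≡rot))

  Edge⇒Sole : ∀ p q → Edge p q → Sole p q ⊎ Sole q p
  Edge⇒Sole p q (inj₁ out)        = inj₁ (Out⇒Sole p q out)
  Edge⇒Sole p q (inj₂ (inj₁ out)) = inj₂ (Out⇒Sole q p out)
  Edge⇒Sole p q (inj₂ (inj₂ mat)) = inj₁ (Match⇒Sole p q mat)

  decode : Fin (K * m) → Pair
  decode = remQuot m

  decode-injective : ∀ {u v} → decode u ≡ decode v → u ≡ v
  decode-injective {u} {v} eq =
    trans (sym (combine-remQuot m u)) (trans (cong (uncurry combine) eq) (combine-remQuot m v))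

  graph : Graph
  graph = record
    { n      = K * m
    ; adj    = λ u v → does (Edge? (decode u) (decode v))
    ; sym    = λ u v → does-⇔ (mk⇔ (Edge-sym _ _) (Edge-sym _ _)) (Edge? (decode u) (decode v)) (Edge? (decode v) (decode u))
    ; irrefl = λ v → dec-false (Edge? (decode v) (decode v)) (λ e → Edge-colours _ _ e refl)
    }

  colouring : Fin (K * m) → Fin K
  colouring = proj₁ ∘ decode

  Adj⇒Edge : ∀ u v → Adj graph u v → Edge (decode u) (decode v)
  Adj⇒Edge u v = does⇒ (Edge? (decode u) (decode v))

  colouring-star : IsStarColouring graph K colouring
  colouring-star = sole-ends⇒star graph colouring proper sole
    where
    proper : Proper graph K colouring
    proper u v uv = Edge-colours (decode u) (decode v) (Adj⇒Edge u v uv)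
    toSoleOfColour : ∀ {u v} → Sole (decode u) (decode v) → SoleOfColour graph colouring u v
    toSoleOfColour {u} {v} sole w vw κw≡κu = decode-injective (sole (decode w) (Adj⇒Edge v w vw) κw≡κu)
    sole : ∀ u v → Adj graph u v → SoleOfColour graph colouring u v ⊎ SoleOfColour graph colouring v u
    sole u v uv with Edge⇒Sole (decode u) (decode v) (Adj⇒Edge u v uv)
    ... | inj₁ u-sole = inj₁ (toSoleOfColour {u} {v} u-sole)
    ... | inj₂ v-sole = inj₂ (toSoleOfColour {v} {u} v-sole)

  outDegree inDegree matchDegree : Pair → ℕ
  outDegree   p = ∑[ c < K ] ∑[ l < m ] [ Out? p (c , l) ]
  inDegree    p = ∑[ c < K ] ∑[ l < m ] [ Out? (c , l) p ]
  matchDegree p = ∑[ c < K ] ∑[ l < m ] [ Match? p (c , l) ]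

  [Edge?]≡ : ∀ p q → [ Edge? p q ] ≡ [ Out? p q ] + ([ Out? q p ] + [ Match? p q ])
  [Edge?]≡ p q = trans ([]-⊎ (Out? p q) (Out? q p ⊎-dec Match? p q) (out-excludes p q))
                       (cong ([ Out? p q ] +_) ([]-⊎ (Out? q p) (Match? p q) (in-excludes-match p q)))
    where
    out-excludes : ∀ p q → Out p q → Out q p ⊎ Match p q → ⊥
    out-excludes (a , j) (c , l) (_ , l≢ , _)      (inj₁ (a≡c[l] , _))       = l≢ (sym (punchOut′-≡ a≡c[l]))
    out-excludes (a , j) (c , l) (_ , _ , l≢rot)   (inj₂ (o , _ , _ , l≡rot)) = l≢rot o l≡rot
    in-excludes-match : ∀ p q → Out q p → Match p q → ⊥
    in-excludes-match (a , j) (c , l) (_ , _ , j≢rot) (o , _ , j≡rot , _) = j≢rot o j≡rot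

  degree≡sum-degrees : ∀ v → degree graph v ≡ outDegree (decode v) + (inDegree (decode v) + matchDegree (decode v))
  degree≡sum-degrees v = begin
    degree graph v                                     ≡⟨ degree≡sum graph v ⟩
    ∑[ w < K * m ] [ Edge? p (decode w) ]              ≡⟨ sum-combine {K} {m} (λ w → [ Edge? p (decode w) ]) ⟩
    ∑[ c < K ] ∑[ l < m ] [ Edge? p (decode (combine c l)) ] ≡⟨ sum-cong-≗ (λ c → sum-cong-≗ (λ l → cong (λ q → [ Edge? p q ]) (remQuot-combine c l))) ⟩
    ∑[ c < K ] ∑[ l < m ] [ Edge? p (c , l) ]          ≡⟨ sum-cong-≗ (λ c → sum-cong-≗ (λ l → [Edge?]≡ p (c , l))) ⟩
    ∑[ c < K ] ∑[ l < m ] ([ Out? p (c , l) ] + ([ Out? (c , l) p ] + [ Match? p (c , l) ]))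
      ≡⟨ sum-cong-≗ (λ c → sum-distrib-+₃ (λ l → [ Out? p (c , l) ]) (λ l → [ Out? (c , l) p ]) (λ l → [ Match? p (c , l) ])) ⟩
    ∑[ c < K ] (∑[ l < m ] [ Out? p (c , l) ] + (∑[ l < m ] [ Out? (c , l) p ] + ∑[ l < m ] [ Match? p (c , l) ]))
      ≡⟨ sum-distrib-+₃ (λ c → ∑[ l < m ] [ Out? p (c , l) ]) (λ c → ∑[ l < m ] [ Out? (c , l) p ]) (λ c → ∑[ l < m ] [ Match? p (c , l) ]) ⟩
    outDegree p + (inDegree p + matchDegree p)         ∎
    where
    open ≡-Reasoning
    p = decode v

  o : ℕ
  o = [ T? odd ]

  sum-[Allowed?-at] : ∀ i → ∑[ l < m ] [ Allowed? i l ] + (1 + o) ≡ m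
  sum-[Allowed?-at] i =
    sum-[¬×⇒¬]+1+b≡size odd (_≟ i) (_≟ rotate i) (λ l l≡i l≡rot → rotate-≢ i (trans (sym l≡rot) l≡i))
                        (sum-[≟i] i) (sum-[≟i] (rotate i))

  sum-[≟rotate] : ∀ j → ∑[ i < m ] [ j ≟ rotate i ] ≡ 1
  sum-[≟rotate] j = trans (sum-rotate (λ i → [ j ≟ i ])) (sum-[i≟] j)

  sum-[Allowed?-from] : ∀ j → ∑[ i < m ] [ Allowed? i j ] + (1 + o) ≡ m
  sum-[Allowed?-from] j =
    sum-[¬×⇒¬]+1+b≡size odd (j ≟_) (λ i → j ≟ rotate i) (λ i j≡i j≡rot → rotate-≢ i (trans (sym j≡rot) j≡i))
                        (sum-[i≟] j) (sum-[≟rotate] j)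

  outDegree-count : ∀ p → outDegree p + (1 + o) ≡ m
  outDegree-count (a , j) = trans (cong (_+ (1 + o)) outDegree≡) (sum-[Allowed?-at] (punchOut′ b a))
    where
    b = punchIn a j
    outDegree≡ : outDegree (a , j) ≡ ∑[ l < m ] [ Allowed? (punchOut′ b a) l ]
    outDegree≡ = begin
      ∑[ c < K ] ∑[ l < m ] [ Out? (a , j) (c , l) ]                          ≡⟨ sum-cong-≗ (λ c → sum-cong-≗ (λ l → []-× (c ≟ b) (Allowed? (punchOut′ c a) l))) ⟩
      ∑[ c < K ] ∑[ l < m ] ([ c ≟ b ] * [ Allowed? (punchOut′ c a) l ])      ≡⟨ sum-cong-≗ (λ c → *-distribˡ-sum [ c ≟ b ] (λ l → [ Allowed? (punchOut′ c a) l ])) ⟨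
      ∑[ c < K ] ([ c ≟ b ] * ∑[ l < m ] [ Allowed? (punchOut′ c a) l ])      ≡⟨ sum-pick b (λ c → ∑[ l < m ] [ Allowed? (punchOut′ c a) l ]) ⟩
      ∑[ l < m ] [ Allowed? (punchOut′ b a) l ]                               ∎
      where open ≡-Reasoning

  inDegree-count : ∀ p → inDegree p + (1 + o) ≡ m
  inDegree-count (a , j) = trans (cong (_+ (1 + o)) inDegree≡) (sum-[Allowed?-from] j)
    where
    inDegree≡ : inDegree (a , j) ≡ ∑[ i < m ] [ Allowed? i j ]
    inDegree≡ = begin
      ∑[ c < K ] ∑[ l < m ] [ Out? (c , l) (a , j) ]                          ≡⟨ sum-cong-≗ (λ c → sum-cong-≗ (λ l → []-× (a ≟ punchIn c l) (Allowed? (punchOut′ a c) j))) ⟩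
      ∑[ c < K ] ∑[ l < m ] ([ a ≟ punchIn c l ] * [ Allowed? (punchOut′ a c) j ]) ≡⟨ sum-cong-≗ (λ c → *-distribʳ-sum [ Allowed? (punchOut′ a c) j ] (λ l → [ a ≟ punchIn c l ])) ⟨
      ∑[ c < K ] (∑[ l < m ] [ a ≟ punchIn c l ] * [ Allowed? (punchOut′ a c) j ]) ≡⟨ sum-fibres-punchIn a (λ c → [ Allowed? (punchOut′ a c) j ]) ⟩
      ∑[ i < m ] [ Allowed? (punchOut′ a (punchIn a i)) j ]                   ≡⟨ sum-cong-≗ (λ i → cong (λ i′ → [ Allowed? i′ j ]) (punchOut′-punchIn a i)) ⟩
      ∑[ i < m ] [ Allowed? i j ]                                             ∎
      where open ≡-Reasoning

  matchDegree≡ : ∀ p → matchDegree p ≡ o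
  matchDegree≡ (a , j) = begin
    ∑[ c < K ] ∑[ l < m ] [ Match? (a , j) (c , l) ]           ≡⟨ sum-cong-≗ (λ c → sum-cong-≗ (λ l → split c l)) ⟩
    ∑[ c < K ] ∑[ l < m ] (o * g c * [ l ≟ rotate (punchOut′ c a) ]) ≡⟨ sum-cong-≗ (λ c → *-distribˡ-sum (o * g c) (λ l → [ l ≟ rotate (punchOut′ c a) ])) ⟨
    ∑[ c < K ] (o * g c * ∑[ l < m ] [ l ≟ rotate (punchOut′ c a) ]) ≡⟨ sum-cong-≗ (λ c → trans (cong (o * g c *_) (sum-[≟i] (rotate (punchOut′ c a)))) (*-identityʳ (o * g c))) ⟩
    ∑[ c < K ] (o * g c)                                     ≡⟨ *-distribˡ-sum o g ⟨
    o * ∑[ c < K ] g c                                       ≡⟨ cong (o *_) sum-g ⟩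
    o * 1                                                    ≡⟨ *-identityʳ o ⟩
    o                                                        ∎
    where
    open ≡-Reasoning
    g : Fin K → ℕ
    g c = [ ¬? (c ≟ a) ] * [ j ≟ rotate (punchOut′ a c) ]
    split : ∀ c l → [ Match? (a , j) (c , l) ] ≡ o * g c * [ l ≟ rotate (punchOut′ c a) ]
    split c l = begin
      [ Match? (a , j) (c , l) ]      ≡⟨ []-× (T? odd) (x ×-dec y ×-dec z) ⟩
      o * [ x ×-dec y ×-dec z ]       ≡⟨ cong (o *_) (trans ([]-× x (y ×-dec z)) (cong ([ x ] *_) ([]-× y z))) ⟩
      o * ([ x ] * ([ y ] * [ z ]))   ≡⟨ cong (o *_) (*-assoc [ x ] [ y ] [ z ]) ⟨
      o * (g c * [ z ])               ≡⟨ *-assoc o (g c) [ z ] ⟨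
      o * g c * [ z ]                 ∎
      where
      x = ¬? (c ≟ a)
      y = j ≟ rotate (punchOut′ a c)
      z = l ≟ rotate (punchOut′ c a)
    sum-g : ∑[ c < K ] g c ≡ 1
    sum-g = begin
      ∑[ c < K ] g c                                        ≡⟨ sum-remove {i = a} g ⟩
      g a + ∑[ i < m ] g (punchIn a i)                      ≡⟨ cong₂ _+_ (cong (_* [ j ≟ rotate (punchOut′ a a) ]) ([]-no (¬? (a ≟ a)) (λ a≢a → a≢a refl)))
                                                                         (sum-cong-≗ (λ i → cong₂ _*_ ([]-yes (¬? (punchIn a i ≟ a)) (punchInᵢ≢i a i))
                                                                                                     (cong (λ i′ → [ j ≟ rotate i′ ]) (punchOut′-punchIn a i)))) ⟩
      ∑[ i < m ] (1 * [ j ≟ rotate i ])                      ≡⟨ sum-cong-≗ (λ i → *-identityˡ [ j ≟ rotate i ]) ⟩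
      ∑[ i < m ] [ j ≟ rotate i ]                            ≡⟨ sum-[≟rotate] j ⟩
      1                                                     ∎

  degree+2+o≡m+m : ∀ v → degree graph v + (2 + o) ≡ m + m
  degree+2+o≡m+m v = begin
    degree graph v + (2 + o)                       ≡⟨ cong (_+ (2 + o)) (degree≡sum-degrees v) ⟩
    outDegree p + (inDegree p + matchDegree p) + (2 + o) ≡⟨ cong (λ t → outDegree p + (inDegree p + t) + (2 + o)) (matchDegree≡ p) ⟩
    outDegree p + (inDegree p + o) + (2 + o)       ≡⟨ regroup (outDegree p) (inDegree p) o ⟩
    (outDegree p + (1 + o)) + (inDegree p + (1 + o)) ≡⟨ cong₂ _+_ (outDegree-count p) (inDegree-count p) ⟩
    m + m                                          ∎
    where
    open ≡-Reasoning
    p = decode v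
    regroup : ∀ x y z → x + (y + z) + (2 + z) ≡ (x + (1 + z)) + (y + (1 + z))
    regroup = solve-∀

ceilHalf-2+ : ∀ x → ceilHalf (2 + x) ≡ suc (ceilHalf x)
ceilHalf-2+ x = m/n≡1+[m∸n]/n {2 + x + 1} {2} (s≤s (s≤s z≤n))

<ceilHalf⇒double< : ∀ {j x} → j < ceilHalf x → j + j < x
<ceilHalf⇒double< {j} {x} j<half = s≤s⁻¹ $ begin
  suc (suc (j + j))  ≡⟨ double j ⟨
  suc j * 2          ≤⟨ *-monoˡ-≤ 2 j<half ⟩
  ceilHalf x * 2     ≤⟨ m/n*n≤m (x + 1) 2 ⟩
  x + 1              ≡⟨ +-comm x 1 ⟩
  suc x              ∎
  where
  open ≤-Reasoning
  double : ∀ j → suc j * 2 ≡ suc (suc (j + j))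
  double = solve-∀

parity-split : ∀ d → 2 ≤ d →
               ∃ λ r → ∃ λ odd → d + (2 + [ T? odd ]) ≡ (2 + r) + (2 + r) × ceilHalf (d + 4) ≡ 3 + r
parity-split 1 (s≤s ())
parity-split 2 _ = 0 , false , refl , refl
parity-split 3 _ = 1 , true , refl , refl
parity-split (suc (suc d@(suc (suc _)))) _ with parity-split d (s≤s (s≤s z≤n))
... | r , odd , degree≡ , ceilHalf≡ =
  suc r , odd , trans (cong (2 +_) degree≡) (cong suc (sym (+-suc (2 + r) (2 + r)))) ,
  trans (ceilHalf-2+ (d + 4)) (cong suc ceilHalf≡)

theorem5 : (d : ℕ) → 2 ≤ d →
    Σ Graph λ G → Regular d G × StarChromaticNumber G (ceilHalf (d + 4))
theorem5 d 2≤d with parity-split d 2≤d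
... | r , odd , degree≡ , ceilHalf≡ = graph , regular-d , colourable , minimal
  where
  open PairGraph r odd
  regular-d : Regular d graph
  regular-d v = +-cancelʳ-≡ (2 + o) (degree graph v) d (trans (degree+2+o≡m+m v) (sym degree≡))
  colourable : StarColourable graph (ceilHalf (d + 4))
  colourable = subst (StarColourable graph) (sym ceilHalf≡) (colouring , colouring-star)
  minimal : ∀ j → j < ceilHalf (d + 4) → ¬ StarColourable graph j
  minimal j j<K colourable-j =
    <⇒≱ (<ceilHalf⇒double< j<K) (star-colouring-bound graph 2≤d regular-d (s≤s z≤n) colourable-j)
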